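{- Let $(M_I,\rhd)$ be a prefactor system over a directed index set $I$ and let $i\le i'\le i''$ be indices in $I$. 1. If $M_I$ is direct (with coherent $\approx$-embeddings $\mathrm{emb}$ satisfying (Dir)), then for all $a_{i''}\in M_{i''}$ and $a_i\in M_i$: $a_{i''}\rhd a_i$ implies $a_{i''}\rhd \mathrm{emb}_{i,i'}(a_i)$. 2. If $M_I$ is inverse (with coherent $\approx$-projections $\mathrm{proj}$ satisfying (Inv)), then for all $a_{i''}\in M_{i''}$ and $a_{i'}\in M_{i'}$: $a_{i''}\rhd a_{i'}$ implies $a_{i''}\rhd \mathrm{proj}_{i',i}(a_{i'})$.
   Context: An index set is a nonempty set $I$ with a reflexive, transitive relation $\le$ that is directed (every finite subset has an upper bound). A system $(M_I,\rhd)$ consists of sets $M_i$ ($i\in I$) and relations $\rhd\subseteq M_{i'}\times M_i$ for all $i\le i'$, reflexive when $i=i'$; a subscript $i$ on an element indicates it lies in $M_i$. Elements $a_i\in M_i$, $b_j\in M_j$ are consistent, $a_i\approx b_j$, iff there exist $i'\ge i,j$ and $a_{i'}\in M_{i'}$ with $a_{i'}\rhd a_i$ and $a_{i'}\rhd b_j$. The system is a prefactor system iff for all $i\le i'$, $a_{i'}\in M_{i'}$, $a_i\in M_i$: $a_{i'}\approx a_i\iff a_{i'}\rhd a_i$. A map $f:M_i\to M_{i'}$ preserves $\approx$ if $a_i\approx b_i$ implies $f(a_i)\approx f(b_i)$. A family of $\approx$-embeddings consists of $\approx$-preserving maps $\mathrm{emb}_{i,i'}:M_i\to M_{i'}$ ($i\le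 i'$) with $\mathrm{emb}_{i,i}(a_i)\approx a_i$ and $\mathrm{emb}_{i',i''}(\mathrm{emb}_{i,i'}(a_i))\approx \mathrm{emb}_{i,i''}(a_i)$; it is coherent iff for all $i\le i'\le i''$: $a_{i'}\rhd a_i$ implies $\mathrm{emb}_{i',i''}(a_{i'})\rhd a_i$. A family of $\approx$-projections consists of $\approx$-preserving maps $\mathrm{proj}_{i',i}:M_{i'}\to M_i$ ($i\le i'$) with $\mathrm{proj}_{i,i}(a_i)\approx a_i$ and $\mathrm{proj}_{i',i}(\mathrm{proj}_{i'',i'}(a_{i''}))\approx\mathrm{proj}_{i'',i}(a_{i''})$; it is coherent iff for all $i\le i'\le i''$: $a_{i''}\rhd a_i$ implies $\mathrm{proj}_{i'',i'}(a_{i''})\rhd a_i$. A prefactor system is direct iff it has coherent $\approx$-embeddings with (Dir): $a_{i'}\rhd a_i\iff a_{i'}\approx\mathrm{emb}_{i,i'}(a_i)$ for all $i\le i'$; it is inverse iff it has coherent $\approx$-projections with (Inv): $a_{i'}\rhd a_i\iff \mathrm{proj}_{i',i}(a_{i'})\approx a_i$ for all $i\le i'$. -}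

module Defs where

open import Level using (Level; _⊔_; suc)
open import Data.Product using (Σ; _×_; _,_; ∃-syntax)
open import Data.List using (List)
open import Data.List.Relation.Unary.All using (All)
open import Relation.Binary.PropositionalEquality using (_≡_)
open import Function using (_⇔_)

record IndexSet (ℓ ℓ' : Level) : Set (suc (ℓ ⊔ ℓ')) where
  field
    Idx      : Set ℓ
    _≤_      : Idx → Idx → Set ℓ'
    nonempty : Idx
    ≤-refl   : ∀ {i} → i ≤ i
    ≤-trans  : ∀ {i j k} → i ≤ j → j ≤ k → i ≤ k
    directed : (xs : List Idx) → ∃[ u ] All (_≤ u) xs

-- A system (M_I, ▷) over an index set I.  The relation ▷ ⊆ M_{i'} × M_i is
-- only meaningful for i ≤ i'; we take it as a family over all pairs of
-- indices and only ever use it where i ≤ i'.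
record System {ℓ ℓ'} (I : IndexSet ℓ ℓ') (m r : Level) : Set (suc (ℓ ⊔ ℓ' ⊔ m ⊔ r)) where
  open IndexSet I
  field
    M    : Idx → Set m
    _▷_  : ∀ {i' i} → M i' → M i → Set r
    ▷-refl : ∀ {i} (a : M i) → a ▷ a

  _≈_ : ∀ {i j} → M i → M j → Set (ℓ ⊔ ℓ' ⊔ m ⊔ r)
  _≈_ {i} {j} a b = ∃[ i' ] (i ≤ i' × j ≤ i' × Σ (M i') λ c → (c ▷ a) × (c ▷ b))

module _ {ℓ ℓ' m r} {I : IndexSet ℓ ℓ'} (S : System I m r) where
  open IndexSet I
  open System S

  IsPrefactor : Set (ℓ ⊔ ℓ' ⊔ m ⊔ r)
  IsPrefactor = ∀ {i i'} → i ≤ i' → (a' : M i') (a : M i) → (a' ≈ a) ⇔ (a' ▷ a)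

  Preserves≈ : ∀ {i j} → (M i → M j) → Set (ℓ ⊔ ℓ' ⊔ m ⊔ r)
  Preserves≈ f = ∀ a b → a ≈ b → f a ≈ f b

  record CoherentEmbeddings : Set (ℓ ⊔ ℓ' ⊔ m ⊔ r) where
    field
      emb       : ∀ {i i'} → i ≤ i' → M i → M i'
      emb-pres  : ∀ {i i'} (p : i ≤ i') → Preserves≈ (emb p)
      emb-id    : ∀ {i} (a : M i) → emb (≤-refl {i}) a ≈ a
      emb-comp  : ∀ {i i' i''} (p : i ≤ i') (q : i' ≤ i'') (a : M i) →
                  emb q (emb p a) ≈ emb (≤-trans p q) a
      emb-coh   : ∀ {i i' i''} (p : i ≤ i') (q : i' ≤ i'') (a' : M i') (a : M i) →
                  a' ▷ a → emb q a' ▷ a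

  record CoherentProjections : Set (ℓ ⊔ ℓ' ⊔ m ⊔ r) where
    field
      proj      : ∀ {i i'} → i ≤ i' → M i' → M i
      proj-pres : ∀ {i i'} (p : i ≤ i') → Preserves≈ (proj p)
      proj-id   : ∀ {i} (a : M i) → proj (≤-refl {i}) a ≈ a
      proj-comp : ∀ {i i' i''} (p : i ≤ i') (q : i' ≤ i'') (a : M i'') →
                  proj p (proj q a) ≈ proj (≤-trans p q) a
      proj-coh  : ∀ {i i' i''} (p : i ≤ i') (q : i' ≤ i'') (a'' : M i'') (a : M i) →
                  a'' ▷ a → proj q a'' ▷ a

  record Direct : Set (ℓ ⊔ ℓ' ⊔ m ⊔ r) where
    field
      embeddings : CoherentEmbeddings
    open CoherentEmbeddings embeddings public
    field
      Dir : ∀ {i i'} (p : i ≤ i') (a' : M i') (a : M i) → (a' ▷ a) ⇔ (a' ≈ emb p a)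

  record Inverse : Set (ℓ ⊔ ℓ' ⊔ m ⊔ r) where
    field
      projections : CoherentProjections
    open CoherentProjections projections public
    field
      Inv : ∀ {i i'} (p : i ≤ i') (a' : M i') (a : M i) → (a' ▷ a) ⇔ (proj p a' ≈ a)

{-# OPTIONS --safe #-}
module Submission where

-- Both parts go through the composite i ≤ i'': (Dir) resp. (Inv) converts
-- between ▷ and ≈, and the composition law of emb resp. proj relates the
-- composite map to the two-step one.  The ≈-steps chain because consistency is
-- transitive within one level of a prefactor system: a ≈ b and b ≈ c in M_i give
-- b ▷ a and b ▷ c, so b itself witnesses a ≈ c.

open import Defs
open import Data.Product using (_×_; _,_)
open import Function.Bundles using (module Equivalence)

open Equivalence using (to; from)

module _ {ℓ ℓ' m r} {I : IndexSet ℓ ℓ'} {S : System I m r} where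
  open IndexSet I
  open System S

  ≈-sym : ∀ {i j} {a : M i} {b : M j} → a ≈ b → b ≈ a
  ≈-sym (k , i≤k , j≤k , c , c▷a , c▷b) = k , j≤k , i≤k , c , c▷b , c▷a

  module _ (prefactor : IsPrefactor S) where

    ≈-trans : ∀ {i} {a b c : M i} → a ≈ b → b ≈ c → a ≈ c
    ≈-trans {i} {a} {b} {c} a≈b b≈c =
      i , ≤-refl , ≤-refl , b ,
      to (prefactor ≤-refl b a) (≈-sym a≈b) , to (prefactor ≤-refl b c) b≈c

    module _ (D : Direct S) where
      open Direct D

      ▷⇒▷-emb : ∀ {i i' i''} (p : i ≤ i') (q : i' ≤ i'') (a'' : M i'') (a : M i) →
                a'' ▷ a → a'' ▷ emb p a
      ▷⇒▷-emb p q a'' a a''▷a = from (Dir q a'' (emb p a)) a''≈emb-q-emb-p-a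
        where
        a''≈emb-pq-a : a'' ≈ emb (≤-trans p q) a
        a''≈emb-pq-a = to (Dir (≤-trans p q) a'' a) a''▷a

        a''≈emb-q-emb-p-a : a'' ≈ emb q (emb p a)
        a''≈emb-q-emb-p-a = ≈-trans a''≈emb-pq-a (≈-sym (emb-comp p q a))

    module _ (V : Inverse S) where
      open Inverse V

      ▷⇒▷-proj : ∀ {i i' i''} (p : i ≤ i') (q : i' ≤ i'') (a'' : M i'') (a' : M i') →
                 a'' ▷ a' → a'' ▷ proj p a'
      ▷⇒▷-proj p q a'' a' a''▷a' = from (Inv (≤-trans p q) a'' (proj p a')) proj-pq-a''≈proj-p-a'
        where
        proj-q-a''≈a' : proj q a'' ≈ a'
        proj-q-a''≈a' = to (Inv q a'' a') a''▷a'

        proj-pq-a''≈proj-p-a' : proj (≤-trans p q) a'' ≈ proj p a'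
        proj-pq-a''≈proj-p-a' =
          ≈-trans (≈-sym (proj-comp p q a'')) (proj-pres p (proj q a'') a' proj-q-a''≈a')

lemma2p5 : ∀ {ℓ ℓ' m r} {I : IndexSet ℓ ℓ'} (S : System I m r) → IsPrefactor S →
    ∀ {i i' i''} (p : IndexSet._≤_ I i i') (q : IndexSet._≤_ I i' i'') →
      ((D : Direct S) → (a'' : System.M S i'') (a : System.M S i) →
        System._▷_ S a'' a → System._▷_ S a'' (Direct.emb D p a))
      × ((V : Inverse S) → (a'' : System.M S i'') (a' : System.M S i') →
        System._▷_ S a'' a' → System._▷_ S a'' (Inverse.proj V p a'))
lemma2p5 S prefactor p q =
  (λ D → ▷⇒▷-emb prefactor D p q) , (λ V → ▷⇒▷-proj prefactor V p q)
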